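{- Let $p$ be a prime, $n\ge1$, $\alpha$ a primitive root (generator of the multiplicative group) of $\mathbb{F}_{p^n}$, and let $0=x_0<x_1<\dots<x_{p^n-1}$ be the $p^n$ fixed points of $g_p^n$ in $[0,1]$. Define $B_\alpha:\mathrm{FP}(g_p^n)\to\mathbb{F}_{p^n}$ by $B_\alpha(x_0)=0$ and $B_\alpha(x_k)=\alpha^{\pi_{p^n}(k)}$ for $0<k<p^n$. Then $B_\alpha$ is a bijection and $(B_\alpha(x_k))^p=B_\alpha(g_p(x_k))$ for every fixed point $x_k\in\mathrm{FP}(g_p^n)$.
   Context: For an integer $p\ge 2$, $g_p:[0,1]\to[0,1]$ is defined, for $k\in\{0,\dots,p-1\}$ and $\frac{k}{p}\le x\le\frac{k+1}{p}$, by $g_p(x)=px-k$ if $k$ is even and $g_p(x)=k+1-px$ if $k$ is odd; $g_p^n$ is its $n$-fold composition and $\mathrm{FP}(g_p^n)$ its set of fixed points in $[0,1]$ (there are exactly $p^n$ of them). The permutation $\pi_{p^n}$ of $\{0,1,\dots,p^n-1\}$ is defined recursively: $\pi_{p^1}$ is the identity on $\{0,\dots,p-1\}$; for $n\ge2$ and $ap^{n-1}\le k<(a+1)p^{n-1}$ (with $0\le a\le p-1$), $\pi_{p^n}(k)=\pi_{p^{n-1}}(k-ap^{n-1})+ap^{n-1}$ if $a$ is even, and $\pi_{p^n}(k)=\pi_{p^{n-1}}(p^{n-1}-(k-ap^{n-1})-1)+ap^{n-1}$ if $a$ is odd.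
   Formalization: The map $g_p$ and its fixed points $x_k$ are taken over the rationals in $[0,1]$ instead of the reals. -}

module Defs where

open import Level using (Level)
open import Data.Nat as ℕ using (ℕ; zero; suc; _∸_; _≡ᵇ_; _<ᵇ_)
open import Data.Nat.DivMod using (_/_; _%_)
open import Data.Integer as ℤ using (ℤ; +_)
open import Data.Rational as ℚ using (ℚ; floor)
open import Data.Fin using (Fin; toℕ)
open import Data.Bool using (if_then_else_)
open import Data.Product using (Σ; _×_; ∃)
open import Relation.Nullary using (¬_)
open import Relation.Binary.PropositionalEquality using (_≡_)
open import Algebra.Bundles using (CommutativeRing; Semiring)

iter : {A : Set} → ℕ → (A → A) → A → A
iter zero    f x = x
iter (suc n) f x = f (iter n f x)

ℕ→ℚ : ℕ → ℚ
ℕ→ℚ k = (+ k) ℚ./ 1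

-- g_p on [0,1] (values outside [0,1], and p = 0, are junk).
-- For x ∈ [0,1], k = min(⌊p x⌋, p-1) is a block with k/p ≤ x ≤ (k+1)/p;
-- at block boundaries both adjacent formulas agree, so this is the paper's g_p.
g : ℕ → ℚ → ℚ
g p x with ℤ.∣ floor (ℕ→ℚ p ℚ.* x) ∣
... | k0 = if k % 2 ≡ᵇ 0 then ℕ→ℚ p ℚ.* x ℚ.- ℕ→ℚ k else ℕ→ℚ (suc k) ℚ.- ℕ→ℚ p ℚ.* x
  where
  k : ℕ
  k = if k0 <ᵇ p then k0 else p ∸ 1

IsFP : ℕ → ℕ → ℚ → Set
IsFP p n y = (ℚ.0ℚ ℚ.≤ y) × (y ℚ.≤ ℚ.1ℚ) × (iter n (g p) y ≡ y)

-- π p m = the permutation π_{p^(m+1)} (as a function on ℕ, meaningful on [0, p^(m+1)))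
π : ℕ → ℕ → ℕ → ℕ
π p zero    k = k
π p (suc m) k with p ℕ.^ suc m
... | zero   = k
... | suc q  = if a % 2 ≡ᵇ 0 then π p m r ℕ.+ a ℕ.* suc q
                             else π p m (suc q ∸ r ∸ 1) ℕ.+ a ℕ.* suc q
  where
  a r : ℕ
  a = k / suc q
  r = k % suc q

module _ {c ℓ : Level} (F : CommutativeRing c ℓ) where
  open CommutativeRing F
  open import Algebra.Definitions.RawSemiring (Semiring.rawSemiring semiring) using (_^_)

  IsField : Set (c Level.⊔ ℓ)
  IsField = (¬ (1# ≈ 0#)) × (∀ y → ¬ (y ≈ 0#) → ∃ λ z → (y * z) ≈ 1#)

  HasCard : ℕ → Set (c Level.⊔ ℓ)
  HasCard N = Σ (Fin N → Carrier) λ e →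
                (∀ i j → e i ≈ e j → i ≡ j) × (∀ y → ∃ λ i → e i ≈ y)

  IsPrimitiveRoot : Carrier → Set (c Level.⊔ ℓ)
  IsPrimitiveRoot α = (¬ (α ≈ 0#)) × (∀ y → ¬ (y ≈ 0#) → ∃ λ k → (α ^ k) ≈ y)

  -- B_α on indices: B(x_0) = 0, B(x_k) = α^{π_{p^n}(k)}
  B : (p n : ℕ) → Carrier → Fin (p ℕ.^ n) → Carrier
  B p n α k = if toℕ k ≡ᵇ 0 then 0# else α ^ π p (n ∸ 1) (toℕ k)

  pow : Carrier → ℕ → Carrier
  pow = _^_

{-# OPTIONS --safe #-}
-- Write each k < N = p ^ n in base p. The k-th fixed point of g_p^n is k/(N-1) or (k+1)/(N+1),
-- according to the parity of the digit sum of π(k), and g_p sends it to the j-th one, where the base-p digits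
-- of π(j) are those of π(k) rotated by one place; rotation is multiplication by p modulo N - 1. As α has order
-- N - 1, this gives B(x_k)^p = α^(p π(k)) = α^(π(j)) = B(x_j). B is a bijection because π is a permutation and
-- k ↦ α^k is injective on [1, N - 1] and onto the nonzero elements.
module Submission where

open import Defs
open import Level using (Level)
open import Data.Nat as ℕ using (ℕ; zero; suc; z≤n; s≤s; s≤s⁻¹; z<s)
import Data.Nat.Properties as ℕ
open import Data.Nat.Primality using (Prime; ¬prime[0]; ¬prime[1])
open import Data.Rational as ℚ using (ℚ)
import Data.Rational.Properties as ℚ
open import Data.Fin as Fin using (Fin; toℕ; fromℕ<)
import Data.Fin.Properties as Fin
open import Data.Bool using (if_then_else_)
open import Data.Product using (_×_; ∃; _,_; proj₁; proj₂)
open import Data.Empty using (⊥-elim)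
open import Function using (_∘_)
open import Relation.Nullary using (¬_; Dec; yes; no)
open import Relation.Binary.Core using (Rel)
open import Relation.Binary.Structures using (IsStrictPartialOrder)
open import Relation.Binary.Definitions using (tri<; tri≈; tri>)
open import Relation.Binary.PropositionalEquality as ≡ using (_≡_)
open import Algebra.Bundles using (CommutativeRing)

module Positional where
  open import Data.Nat
  open import Data.Nat.Properties
  open import Data.Nat.DivMod
  open import Data.Nat.Tactic.RingSolver using (solve-∀)
  open import Data.Bool using (Bool; true; false; not; _xor_)
  open import Data.Bool.Properties using (xor-identityʳ; not-involutive)
  open import Relation.Binary.PropositionalEquality
  open ≡-Reasoning

  [m*n+o]%n≡o : ∀ m n o .{{_ : NonZero n}} → o < n → (m * n + o) % n ≡ o
  [m*n+o]%n≡o m n o o<n = begin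
    (m * n + o) % n ≡⟨ cong (_% n) (+-comm (m * n) o) ⟩
    (o + m * n) % n ≡⟨ [m+kn]%n≡m%n o m n ⟩
    o % n           ≡⟨ m<n⇒m%n≡m o<n ⟩
    o               ∎

  [m*n+o]/n≡m : ∀ m n o .{{_ : NonZero n}} → o < n → (m * n + o) / n ≡ m
  [m*n+o]/n≡m m n o o<n = begin
    (m * n + o) / n   ≡⟨ +-distrib-/ (m * n) o remainders< ⟩
    m * n / n + o / n ≡⟨ cong₂ _+_ (m*n/n≡m m n) (m<n⇒m/n≡0 o<n) ⟩
    m + 0             ≡⟨ +-identityʳ m ⟩
    m                 ∎
    where
    remainders< : m * n % n + o % n < n
    remainders< = subst (_< n) (sym (cong₂ _+_ (m*n%n≡0 m n) (m<n⇒m%n≡m o<n))) o<n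

  o+m*n<l*n : ∀ {l m n o} → m < l → o < n → o + m * n < l * n
  o+m*n<l*n {n = n} m<l o<n = ≤-trans (+-monoˡ-< _ o<n) (*-monoˡ-≤ n m<l)

  n*m+o<n*l : ∀ {l m n o} → m < l → o < n → n * m + o < n * l
  n*m+o<n*l {l} {m} {n} {o} m<l o<n =
    subst₂ _<_ (trans (+-comm o (m * n)) (cong (_+ o) (*-comm m n))) (*-comm l n) (o+m*n<l*n m<l o<n)

  -- r ↦ m - 1 - r on [0, m), written exactly as in Defs.π so that π unfolds to it.
  reflectIf : Bool → ℕ → ℕ → ℕ
  reflectIf false m r = r
  reflectIf true  m r = m ∸ r ∸ 1

  m≡n+1+o⇒m∸n∸1≡o : ∀ {m n} o → m ≡ n + suc o → m ∸ n ∸ 1 ≡ o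
  m≡n+1+o⇒m∸n∸1≡o {n = n} o refl = cong (_∸ 1) (m+n∸m≡n n (suc o))

  reflectIf-< : ∀ b {m r} → r < m → reflectIf b m r < m
  reflectIf-< false r<m = r<m
  reflectIf-< true {m} {r} r<m with m≤n⇒∃[o]m+o≡n r<m
  ... | e , refl = subst (_< suc r + e) (sym (m≡n+1+o⇒m∸n∸1≡o e (sym (+-suc r e)))) (m<n+m e (s≤s z≤n))

  reflectIf-involutive : ∀ b {m r} → r < m → reflectIf b m (reflectIf b m r) ≡ r
  reflectIf-involutive false r<m = refl
  reflectIf-involutive true {m} {r} r<m with m≤n⇒∃[o]m+o≡n r<m
  ... | e , refl = begin
    suc r + e ∸ (suc r + e ∸ r ∸ 1) ∸ 1
      ≡⟨ cong (λ z → suc r + e ∸ z ∸ 1) (m≡n+1+o⇒m∸n∸1≡o e (sym (+-suc r e))) ⟩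
    suc r + e ∸ e ∸ 1                   ≡⟨ m≡n+1+o⇒m∸n∸1≡o r (+-comm (suc r) e) ⟩
    r                                   ∎

  reflectIf-digits : ∀ b {m n r s} → r < m → s < n →
                     reflectIf b (n * m) (n * r + s) ≡ n * reflectIf b m r + reflectIf b n s
  reflectIf-digits false r<m s<n = refl
  reflectIf-digits true {m} {n} {r} {s} r<m s<n with m≤n⇒∃[o]m+o≡n r<m | m≤n⇒∃[o]m+o≡n s<n
  ... | e , refl | f , refl =
    trans (m≡n+1+o⇒m∸n∸1≡o _ (expand r e s f))
          (sym (cong₂ (λ x y → (suc s + f) * x + y)
                      (m≡n+1+o⇒m∸n∸1≡o e (sym (+-suc r e))) (m≡n+1+o⇒m∸n∸1≡o f (sym (+-suc s f)))))
    where
    expand : ∀ r e s f → (suc s + f) * (suc r + e) ≡ ((suc s + f) * r + s) + suc ((suc s + f) * e + f)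
    expand = solve-∀

  reflectIf-xor : ∀ b c {m r} → r < m → reflectIf (b xor c) m r ≡ reflectIf b m (reflectIf c m r)
  reflectIf-xor b     false r<m = cong (λ z → reflectIf z _ _) (xor-identityʳ b)
  reflectIf-xor false true  r<m = refl
  reflectIf-xor true  true  r<m = sym (reflectIf-involutive true r<m)

  positive-residue-unique : ∀ {n x y i j} → 0 < x → x ≤ n → 0 < y → y ≤ n → x + i * n ≡ y + j * n → x ≡ y
  positive-residue-unique {suc n} {suc x} {suc y} {i} {j} _ (s≤s x≤n) _ (s≤s y≤n) eq = cong suc (begin
    x                   ≡⟨ m<n⇒m%n≡m (s≤s x≤n) ⟨
    x % suc n           ≡⟨ [m+kn]%n≡m%n x i (suc n) ⟨
    (x + i * suc n) % suc n ≡⟨ cong (_% suc n) (suc-injective eq) ⟩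
    (y + j * suc n) % suc n ≡⟨ [m+kn]%n≡m%n y j (suc n) ⟩
    y % suc n           ≡⟨ m<n⇒m%n≡m (s≤s y≤n) ⟩
    y                   ∎)

  isOdd : ℕ → Bool
  isOdd a = not (a % 2 ≡ᵇ 0)

  isOdd-suc : ∀ a → isOdd (suc a) ≡ not (isOdd a)
  isOdd-suc zero    = refl
  isOdd-suc (suc a) = begin
    isOdd (2 + a)           ≡⟨ cong (λ z → not (z ≡ᵇ 0)) (trans (cong (_% 2) (+-comm 2 a)) ([m+n]%n≡m%n a 2)) ⟩
    isOdd a                 ≡⟨ not-involutive (isOdd a) ⟨
    not (not (isOdd a))     ≡⟨ cong not (isOdd-suc a) ⟨
    not (isOdd (suc a))     ∎

module Expansion (p₀ : ℕ) where
  open import Data.Nat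
  open import Data.Nat.Properties
  open import Data.Nat.DivMod
  open import Data.Nat.Tactic.RingSolver using (solve-∀)
  open import Data.Bool using (Bool; true; false; _xor_)
  open import Data.Bool.Properties using (xor-assoc; xor-comm; xor-identityʳ; xor-same)
  open import Relation.Binary.PropositionalEquality
  open ≡-Reasoning
  open Positional

  p : ℕ
  p = suc (suc p₀)

  p^t≢0 : ∀ t → NonZero (p ^ t)
  p^t≢0 t = m^n≢0 p t

  Π : ℕ → ℕ → ℕ
  Π zero    k = k
  Π (suc t) k = π p t k

  lead rest : ℕ → ℕ → ℕ
  lead t k = _/_ k (p ^ t) {{p^t≢0 t}}
  rest t k = _%_ k (p ^ t) {{p^t≢0 t}}

  digits : ∀ t k → k ≡ lead t k * p ^ t + rest t k
  digits t k = trans (m≡m%n+[m/n]*n k (p ^ t) {{p^t≢0 t}}) (+-comm (rest t k) _)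

  lead-< : ∀ t {k} → k < p ^ suc t → lead t k < p
  lead-< t k< = m<n*o⇒m/o<n {{p^t≢0 t}} k<

  rest-< : ∀ t k → rest t k < p ^ t
  rest-< t k = m%n<n k (p ^ t) {{p^t≢0 t}}

  lead-digits : ∀ t a {r} → r < p ^ t → lead t (a * p ^ t + r) ≡ a
  lead-digits t a {r} = [m*n+o]/n≡m a (p ^ t) r {{p^t≢0 t}}

  rest-digits : ∀ t a {r} → r < p ^ t → rest t (a * p ^ t + r) ≡ r
  rest-digits t a {r} = [m*n+o]%n≡o a (p ^ t) r {{p^t≢0 t}}

  Π-digits : ∀ t a {r} → r < p ^ t → Π (suc t) (a * p ^ t + r) ≡ Π t (reflectIf (isOdd a) (p ^ t) r) + a * p ^ t
  Π-digits zero a (s≤s z≤n) with isOdd a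
  ... | false = +-identityʳ (a * 1)
  ... | true  = +-identityʳ (a * 1)
  -- Abstracting p ^ suc t, whose normal form is a successor, lets Defs.π take its recursive branch.
  Π-digits (suc t) a {r} r< with p ^ suc t
  ... | suc q rewrite [m*n+o]/n≡m a (suc q) r r< | [m*n+o]%n≡o a (suc q) r r<
                with a % 2 ≡ᵇ 0
  ...   | true  = refl
  ...   | false = refl

  low : ℕ → ℕ → ℕ
  low t k = reflectIf (isOdd (lead t k)) (p ^ t) (rest t k)

  low-< : ∀ t k → low t k < p ^ t
  low-< t k = reflectIf-< (isOdd (lead t k)) (rest-< t k)

  Π-lead : ∀ t k → Π (suc t) k ≡ Π t (low t k) + lead t k * p ^ t
  Π-lead t k = trans (cong (Π (suc t)) (digits t k)) (Π-digits t (lead t k) (rest-< t k))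

  Π-< : ∀ t {k} → k < p ^ t → Π t k < p ^ t
  Π-< zero    k< = k<
  Π-< (suc t) {k} k< = subst (_< p ^ suc t) (sym (Π-lead t k)) (o+m*n<l*n (lead-< t k<) (Π-< t (low-< t k)))

  Π-zero : ∀ t → Π t 0 ≡ 0
  Π-zero zero    = refl
  Π-zero (suc t) = trans (Π-digits t 0 (m^n>0 p t)) (cong (_+ 0) (Π-zero t))

  Π⁻¹ : ℕ → ℕ → ℕ
  Π⁻¹ zero    s = s
  Π⁻¹ (suc t) s = reflectIf (isOdd (lead t s)) (p ^ t) (Π⁻¹ t (rest t s)) + lead t s * p ^ t

  Π⁻¹-< : ∀ t {s} → s < p ^ t → Π⁻¹ t s < p ^ t
  Π⁻¹-< zero    s< = s<
  Π⁻¹-< (suc t) {s} s< = o+m*n<l*n (lead-< t s<) (reflectIf-< (isOdd (lead t s)) (Π⁻¹-< t (rest-< t s)))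

  Π-Π⁻¹ : ∀ t {s} → s < p ^ t → Π t (Π⁻¹ t s) ≡ s
  Π-Π⁻¹ zero    s< = refl
  Π-Π⁻¹ (suc t) {s} s< = begin
    Π (suc t) (reflectIf c (p ^ t) v + a * p ^ t)  ≡⟨ cong (Π (suc t)) (+-comm (reflectIf c (p ^ t) v) _) ⟩
    Π (suc t) (a * p ^ t + reflectIf c (p ^ t) v)  ≡⟨ Π-digits t a v̄< ⟩
    Π t (reflectIf c (p ^ t) (reflectIf c (p ^ t) v)) + a * p ^ t
                                                   ≡⟨ cong (λ z → Π t z + a * p ^ t) (reflectIf-involutive c v<) ⟩
    Π t v + a * p ^ t                              ≡⟨ cong (_+ a * p ^ t) (Π-Π⁻¹ t (rest-< t s)) ⟩
    rest t s + a * p ^ t                           ≡⟨ trans (+-comm (rest t s) _) (sym (digits t s)) ⟩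
    s                                              ∎
    where
    a = lead t s
    c = isOdd a
    v = Π⁻¹ t (rest t s)
    v< = Π⁻¹-< t (rest-< t s)
    v̄< = reflectIf-< c v<

  Π⁻¹-Π : ∀ t {k} → k < p ^ t → Π⁻¹ t (Π t k) ≡ k
  Π⁻¹-Π zero    k< = refl
  Π⁻¹-Π (suc t) {k} k< = begin
    Π⁻¹ (suc t) (Π (suc t) k)          ≡⟨ cong (Π⁻¹ (suc t)) (trans (Π-lead t k) (+-comm (Π t w) _)) ⟩
    Π⁻¹ (suc t) (a * p ^ t + Π t w)    ≡⟨ cong₂ (λ x y → reflectIf (isOdd x) (p ^ t) (Π⁻¹ t y) + x * p ^ t)
                                                (lead-digits t a Πw<) (rest-digits t a Πw<) ⟩
    reflectIf c (p ^ t) (Π⁻¹ t (Π t w)) + a * p ^ t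
                                       ≡⟨ cong (λ z → reflectIf c (p ^ t) z + a * p ^ t) (Π⁻¹-Π t (low-< t k)) ⟩
    reflectIf c (p ^ t) w + a * p ^ t  ≡⟨ cong (_+ a * p ^ t) (reflectIf-involutive c (rest-< t k)) ⟩
    rest t k + a * p ^ t               ≡⟨ trans (+-comm (rest t k) _) (sym (digits t k)) ⟩
    k                                  ∎
    where
    a = lead t k
    c = isOdd a
    w = low t k
    Πw< = Π-< t (low-< t k)

  Π-injective : ∀ t {i j} → i < p ^ t → j < p ^ t → Π t i ≡ Π t j → i ≡ j
  Π-injective t {i} {j} i< j< eq = begin
    i               ≡⟨ Π⁻¹-Π t i< ⟨
    Π⁻¹ t (Π t i)   ≡⟨ cong (Π⁻¹ t) eq ⟩
    Π⁻¹ t (Π t j)   ≡⟨ Π⁻¹-Π t j< ⟩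
    j               ∎

  digitParity : ℕ → ℕ → Bool
  digitParity zero    m = false
  digitParity (suc t) m = digitParity t (m / p) xor isOdd (m % p)

  digitParity-low : ∀ t X {c} → c < p → digitParity (suc t) (p * X + c) ≡ digitParity t X xor isOdd c
  digitParity-low t X {c} c<p = cong₂ (λ x y → digitParity t x xor isOdd y)
    (trans (cong (λ z → (z + c) / p) (*-comm p X)) ([m*n+o]/n≡m X p c c<p))
    (trans (cong (λ z → (z + c) % p) (*-comm p X)) ([m*n+o]%n≡o X p c c<p))

  digitParity-lead : ∀ t {X a} → X < p ^ t → a < p → digitParity (suc t) (X + a * p ^ t) ≡ digitParity t X xor isOdd a
  digitParity-lead zero {a = a} (s≤s z≤n) a<p = trans (cong (λ z → isOdd (z % p)) (*-identityʳ a)) (cong isOdd (m<n⇒m%n≡m a<p))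
  digitParity-lead (suc t) {X} {a} X< a<p = begin
    digitParity (2 + t) (X + a * (p * p ^ t))
      ≡⟨ cong (digitParity (2 + t)) (trans (cong (_+ a * (p * p ^ t)) (split X)) (regroup p (X / p) a (p ^ t) (X % p))) ⟩
    digitParity (2 + t) (p * (X / p + a * p ^ t) + X % p)
      ≡⟨ digitParity-low (suc t) (X / p + a * p ^ t) (m%n<n X p) ⟩
    digitParity (suc t) (X / p + a * p ^ t) xor isOdd (X % p)
      ≡⟨ cong (_xor isOdd (X % p)) (digitParity-lead t (m<n*o⇒m/o<n (subst (X <_) (*-comm p (p ^ t)) X<)) a<p) ⟩
    (digitParity t (X / p) xor isOdd a) xor isOdd (X % p)
      ≡⟨ xor-assoc (digitParity t (X / p)) _ _ ⟩
    digitParity t (X / p) xor (isOdd a xor isOdd (X % p))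
      ≡⟨ cong (digitParity t (X / p) xor_) (xor-comm (isOdd a) _) ⟩
    digitParity t (X / p) xor (isOdd (X % p) xor isOdd a)
      ≡⟨ xor-assoc (digitParity t (X / p)) _ _ ⟨
    digitParity (suc t) X xor isOdd a ∎
    where
    split : ∀ X → X ≡ p * (X / p) + X % p
    split X = trans (m≡m%n+[m/n]*n X p) (trans (+-comm (X % p) _) (cong (_+ X % p) (*-comm (X / p) p)))
    regroup : ∀ p Y a P c → (p * Y + c) + a * (p * P) ≡ p * (Y + a * P) + c
    regroup = solve-∀

  digitParity-Π : ∀ t {k} → k < p ^ suc t →
                  digitParity (suc t) (Π (suc t) k) ≡ digitParity t (Π t (low t k)) xor isOdd (lead t k)
  digitParity-Π t {k} k< = trans (cong (digitParity (suc t)) (Π-lead t k)) (digitParity-lead t (Π-< t (low-< t k)) (lead-< t k<))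

  Π-last : ∀ t {r b} → r < p ^ t → b < p → Π (suc t) (p * r + b) ≡ p * Π t r + reflectIf (digitParity t (Π t r)) p b
  Π-last zero    (s≤s z≤n) b<p = refl
  Π-last (suc t) {r} {b} r< b<p = begin
    Π (2 + t) (p * r + b)
      ≡⟨ cong (Π (2 + t)) (trans (cong (λ z → p * z + b) (digits t r)) (regroup p a (p ^ t) (rest t r) b)) ⟩
    Π (2 + t) (a * (p * p ^ t) + (p * rest t r + b))
      ≡⟨ Π-digits (suc t) a (n*m+o<n*l (rest-< t r) b<p) ⟩
    Π (suc t) (reflectIf c (p * p ^ t) (p * rest t r + b)) + a * (p * p ^ t)
      ≡⟨ cong (λ z → Π (suc t) z + a * (p * p ^ t)) (reflectIf-digits c (rest-< t r) b<p) ⟩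
    Π (suc t) (p * w + reflectIf c p b) + a * (p * p ^ t)
      ≡⟨ cong (_+ a * (p * p ^ t)) (Π-last t (low-< t r) (reflectIf-< c b<p)) ⟩
    p * Π t w + reflectIf (digitParity t (Π t w)) p (reflectIf c p b) + a * (p * p ^ t)
      ≡⟨ cong (λ z → p * Π t w + z + a * (p * p ^ t)) (sym (reflectIf-xor (digitParity t (Π t w)) c b<p)) ⟩
    p * Π t w + reflectIf (digitParity t (Π t w) xor c) p b + a * (p * p ^ t)
      ≡⟨ regroup′ p (Π t w) a (p ^ t) _ ⟩
    p * (Π t w + a * p ^ t) + reflectIf (digitParity t (Π t w) xor c) p b
      ≡⟨ sym (cong₂ (λ x y → p * x + reflectIf y p b) (Π-lead t r) (digitParity-Π t r<)) ⟩
    p * Π (suc t) r + reflectIf (digitParity (suc t) (Π (suc t) r)) p b ∎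
    where
    a = lead t r
    c = isOdd a
    w = low t r
    regroup : ∀ p a P r b → p * (a * P + r) + b ≡ a * (p * P) + (p * r + b)
    regroup = solve-∀
    regroup′ : ∀ p X a P c → p * X + c + a * (p * P) ≡ p * (X + a * P) + c
    regroup′ = solve-∀

  -- p ^ suc t = 2 + d t: a field with p ^ suc t elements has a multiplicative group of order suc (d t).
  d : ℕ → ℕ
  d t = p ^ suc t ∸ 2

  p^[1+t]≡2+d : ∀ t → p ^ suc t ≡ suc (suc (d t))
  p^[1+t]≡2+d t = sym (m+[n∸m]≡n {2} (*-mono-≤ {2} {p} {1} (s≤s (s≤s z≤n)) (m^n>0 p t)))

  <N⇒≤1+d : ∀ t {j} → j < p ^ suc t → j ≤ suc (d t)
  <N⇒≤1+d t {j} j< = s≤s⁻¹ (subst (j <_) (p^[1+t]≡2+d t) j<)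

  rotate : ℕ → ℕ → ℕ
  rotate t m = p * rest t m + lead t m

  rotate-< : ∀ t {m} → m < p ^ suc t → rotate t m < p ^ suc t
  rotate-< t {m} m< = n*m+o<n*l (rest-< t m) (lead-< t m<)

  -- Rotating the base-p digits of m is multiplication by p modulo p ^ suc t - 1.
  p*m≡rotate : ∀ t m → p * m ≡ rotate t m + lead t m * suc (d t)
  p*m≡rotate t m = begin
    p * m                                       ≡⟨ cong (p *_) (digits t m) ⟩
    p * (lead t m * p ^ t + rest t m)           ≡⟨ regroup p (lead t m) (p ^ t) (rest t m) ⟩
    p * rest t m + lead t m * (p * p ^ t)       ≡⟨ cong (λ z → p * rest t m + lead t m * z) (p^[1+t]≡2+d t) ⟩
    p * rest t m + lead t m * suc (suc (d t))   ≡⟨ unfold (p * rest t m) (lead t m) (d t) ⟩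
    rotate t m + lead t m * suc (d t)           ∎
    where
    regroup : ∀ p a P r → p * (a * P + r) ≡ p * r + a * (p * P)
    regroup = solve-∀
    unfold : ∀ x a d → x + a * suc (suc d) ≡ (x + a) + a * suc d
    unfold = solve-∀

  rotate-zero : ∀ t → rotate t 0 ≡ 0
  rotate-zero t = trans (cong₂ (λ x y → p * x + y) (rest-digits t 0 (m^n>0 p t)) (lead-digits t 0 (m^n>0 p t)))
                      (trans (+-identityʳ (p * 0)) (*-zeroʳ p))

  rotate-pos : ∀ t {m} → 0 < m → 0 < rotate t m
  rotate-pos t {m} 0<m = n≢0⇒n>0 λ rot≡0 → <⇒≢ 0<m (sym (begin
    m                             ≡⟨ digits t m ⟩
    lead t m * p ^ t + rest t m   ≡⟨ cong₂ (λ x y → x * p ^ t + y) (m+n≡0⇒n≡0 (p * rest t m) rot≡0)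
                                          (m*n≡0⇒m≡0 (rest t m) p (trans (*-comm (rest t m) p) (m+n≡0⇒m≡0 _ rot≡0))) ⟩
    0                             ∎))

  iter-rotate-< : ∀ t i {m} → m < p ^ suc t → iter i (rotate t) m < p ^ suc t
  iter-rotate-< t zero    m< = m<
  iter-rotate-< t (suc i) m< = rotate-< t (iter-rotate-< t i m<)

  iter-rotate-pos : ∀ t i {m} → 0 < m → 0 < iter i (rotate t) m
  iter-rotate-pos t zero    0<m = 0<m
  iter-rotate-pos t (suc i) 0<m = rotate-pos t (iter-rotate-pos t i 0<m)

  iter-rotate-zero : ∀ t i → iter i (rotate t) 0 ≡ 0
  iter-rotate-zero t zero    = refl
  iter-rotate-zero t (suc i) = trans (cong (rotate t) (iter-rotate-zero t i)) (rotate-zero t)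

  p^i*m≡iter-rotate : ∀ t i m → ∃ λ c → p ^ i * m ≡ iter i (rotate t) m + c * suc (d t)
  p^i*m≡iter-rotate t zero    m = 0 , trans (*-identityˡ m) (sym (+-identityʳ m))
  p^i*m≡iter-rotate t (suc i) m with p^i*m≡iter-rotate t i m
  ... | c , eq = lead t mᵢ + p * c , (begin
    p * p ^ i * m                                ≡⟨ trans (*-assoc p (p ^ i) m) (cong (p *_) eq) ⟩
    p * (mᵢ + c * suc (d t))                     ≡⟨ *-distribˡ-+ p mᵢ _ ⟩
    p * mᵢ + p * (c * suc (d t))                 ≡⟨ cong (_+ p * (c * suc (d t))) (p*m≡rotate t mᵢ) ⟩
    rotate t mᵢ + lead t mᵢ * suc (d t) + p * (c * suc (d t))
                                                 ≡⟨ collect (rotate t mᵢ) (lead t mᵢ) p c (suc (d t)) ⟩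
    rotate t mᵢ + (lead t mᵢ + p * c) * suc (d t) ∎)
    where
    mᵢ = iter i (rotate t) m
    collect : ∀ x a p c L → x + a * L + p * (c * L) ≡ x + (a + p * c) * L
    collect = solve-∀

  rotate-periodic : ∀ t {m} → m < p ^ suc t → iter (suc t) (rotate t) m ≡ m
  rotate-periodic t {zero}  m< = iter-rotate-zero t (suc t)
  rotate-periodic t {suc m} m< with p^i*m≡iter-rotate t (suc t) (suc m)
  ... | c , eq = sym (positive-residue-unique {i = suc m} {j = c} z<s (<N⇒≤1+d t m<) (iter-rotate-pos t (suc t) z<s)
                       (<N⇒≤1+d t (iter-rotate-< t (suc t) m<)) (trans (unrotate (suc m)) eq))
    where
    unrotate : ∀ x → x + x * suc (d t) ≡ p ^ suc t * x
    unrotate x = trans (cong (x +_) (*-comm x (suc (d t)))) (cong (_* x) (sym (p^[1+t]≡2+d t)))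

  -- The index of g(x_k) (see g-fixedPoint): the base-p digits of π(k) are rotated.
  shift : ℕ → ℕ → ℕ
  shift t k = Π⁻¹ (suc t) (rotate t (Π (suc t) k))

  shift-< : ∀ t {k} → k < p ^ suc t → shift t k < p ^ suc t
  shift-< t k< = Π⁻¹-< (suc t) (rotate-< t (Π-< (suc t) k<))

  Π-shift : ∀ t {k} → k < p ^ suc t → Π (suc t) (shift t k) ≡ rotate t (Π (suc t) k)
  Π-shift t k< = Π-Π⁻¹ (suc t) (rotate-< t (Π-< (suc t) k<))

  shift-zero : ∀ t → shift t 0 ≡ 0
  shift-zero t = Π-injective (suc t) (shift-< t 0<N) 0<N
    (trans (Π-shift t 0<N) (trans (cong (rotate t) (Π-zero (suc t))) (trans (rotate-zero t) (sym (Π-zero (suc t))))))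
    where 0<N = m^n>0 p (suc t)

  iter-shift-< : ∀ t i {k} → k < p ^ suc t → iter i (shift t) k < p ^ suc t
  iter-shift-< t zero    k< = k<
  iter-shift-< t (suc i) k< = shift-< t (iter-shift-< t i k<)

  Π-iter-shift : ∀ t i {k} → k < p ^ suc t → Π (suc t) (iter i (shift t) k) ≡ iter i (rotate t) (Π (suc t) k)
  Π-iter-shift t zero    k< = refl
  Π-iter-shift t (suc i) k< = trans (Π-shift t (iter-shift-< t i k<)) (cong (rotate t) (Π-iter-shift t i k<))

  shift-periodic : ∀ t {k} → k < p ^ suc t → iter (suc t) (shift t) k ≡ k
  shift-periodic t k< = Π-injective (suc t) (iter-shift-< t (suc t) k<) k<
    (trans (Π-iter-shift t (suc t) k<) (rotate-periodic t (Π-< (suc t) k<)))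

  rotate-Π : ∀ t {k} → k < p ^ suc t → rotate t (Π (suc t) k) ≡ p * Π t (low t k) + lead t k
  rotate-Π t {k} k< = cong₂ (λ x y → p * x + y)
    (trans (cong (rest t) Πk) (rest-digits t (lead t k) (Π-< t (low-< t k))))
    (trans (cong (lead t) Πk) (lead-digits t (lead t k) (Π-< t (low-< t k))))
    where
    Πk : Π (suc t) k ≡ lead t k * p ^ t + Π t (low t k)
    Πk = trans (Π-lead t k) (+-comm (Π t (low t k)) _)

  shift-digits : ∀ t {k} → k < p ^ suc t →
                 shift t k ≡ p * low t k + reflectIf (digitParity (suc t) (Π (suc t) k) xor isOdd (lead t k)) p (lead t k)
  shift-digits t {k} k< = Π-injective (suc t) (shift-< t k<) (n*m+o<n*l (low-< t k) (reflectIf-< o′ a<)) (begin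
    Π (suc t) (shift t k)                                  ≡⟨ trans (Π-shift t k<) (rotate-Π t k<) ⟩
    p * Π t w + a                                          ≡⟨ cong (p * Π t w +_) (reflectIf-involutive e a<) ⟨
    p * Π t w + reflectIf e p (reflectIf e p a)            ≡⟨ cong (λ z → p * Π t w + reflectIf e p (reflectIf z p a)) e≡o′ ⟩
    p * Π t w + reflectIf e p (reflectIf o′ p a)           ≡⟨ Π-last t (low-< t k) (reflectIf-< o′ a<) ⟨
    Π (suc t) (p * w + reflectIf o′ p a)                   ∎)
    where
    a = lead t k
    a< = lead-< t k<
    w = low t k
    e = digitParity t (Π t w)
    o′ = digitParity (suc t) (Π (suc t) k) xor isOdd a
    e≡o′ : e ≡ o′
    e≡o′ = sym (trans (cong (_xor isOdd a) (digitParity-Π t k<))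
                      (trans (xor-assoc e (isOdd a) (isOdd a)) (trans (cong (e xor_) (xor-same (isOdd a))) (xor-identityʳ e))))

  digitParity-shift : ∀ t {k} → k < p ^ suc t → digitParity (suc t) (Π (suc t) (shift t k)) ≡ digitParity (suc t) (Π (suc t) k)
  digitParity-shift t {k} k< = begin
    digitParity (suc t) (Π (suc t) (shift t k))        ≡⟨ cong (digitParity (suc t)) (trans (Π-shift t k<) (rotate-Π t k<)) ⟩
    digitParity (suc t) (p * Π t (low t k) + lead t k) ≡⟨ digitParity-low t _ (lead-< t k<) ⟩
    digitParity t (Π t (low t k)) xor isOdd (lead t k) ≡⟨ digitParity-Π t k< ⟨
    digitParity (suc t) (Π (suc t) k)                  ∎

module Fractions where
  open import Data.Nat.DivMod using (_/_)
  open import Data.Nat.Tactic.RingSolver using (solve-∀)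
  open import Data.Integer as ℤ using (+_; -[1+_])
  import Data.Integer.Properties as ℤ
  open import Data.Rational using (mkℚ; floor; toℚᵘ; fromℚᵘ)
  open import Data.Rational.Unnormalised as ℚᵘ using (ℚᵘ; mkℚᵘ; *≡*; *≤*; *<*; _≃_)
  import Data.Rational.Unnormalised.Properties as ℚᵘ
  open import Relation.Binary.PropositionalEquality
  open Positional using ([m*n+o]/n≡m)

  -- u /suc d is the rational u / (1 + d); abstract so that its gcd normalisation is never unfolded.
  infix 7 _/suc_

  abstract
    _/suc_ : ℕ → ℕ → ℚ
    u /suc d = fromℚᵘ (mkℚᵘ (+ u) d)

    toℚᵘ-/suc : ∀ u d → toℚᵘ (u /suc d) ≃ mkℚᵘ (+ u) d
    toℚᵘ-/suc u d = ℚ.toℚᵘ-fromℚᵘ (mkℚᵘ (+ u) d)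

  private
    ⟦_/suc_⟧ : ℕ → ℕ → ℚᵘ
    ⟦ u /suc d ⟧ = mkℚᵘ (+ u) d

    ≃⇒≡/suc : ∀ {q u d} → toℚᵘ q ≃ ⟦ u /suc d ⟧ → q ≡ u /suc d
    ≃⇒≡/suc {u = u} {d} q≃ = ℚ.toℚᵘ-injective (ℚᵘ.≃-trans q≃ (ℚᵘ.≃-sym (toℚᵘ-/suc u d)))

    toℚᵘ-ℕ→ℚ : ∀ a → toℚᵘ (ℕ→ℚ a) ≃ ⟦ a /suc 0 ⟧
    toℚᵘ-ℕ→ℚ a = ℚ.toℚᵘ-fromℚᵘ ⟦ a /suc 0 ⟧

    +u*+v : ∀ u v → + u ℤ.* + v ≡ + (u ℕ.* v)
    +u*+v u v = sym (ℤ.pos-* u v)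

    ⟦⟧-≤ : ∀ {u d v e} → u ℕ.* suc e ℕ.≤ v ℕ.* suc d → ⟦ u /suc d ⟧ ℚᵘ.≤ ⟦ v /suc e ⟧
    ⟦⟧-≤ {u} {d} {v} {e} le = *≤* (subst₂ ℤ._≤_ (ℤ.pos-* u (suc e)) (ℤ.pos-* v (suc d)) (ℤ.+≤+ le))

    ⟦⟧-< : ∀ {u d v e} → u ℕ.* suc e ℕ.< v ℕ.* suc d → ⟦ u /suc d ⟧ ℚᵘ.< ⟦ v /suc e ⟧
    ⟦⟧-< {u} {d} {v} {e} lt = *<* (subst₂ ℤ._<_ (ℤ.pos-* u (suc e)) (ℤ.pos-* v (suc d)) (ℤ.+<+ lt))

    m/n≡a : ∀ {m n a} → a ℕ.* suc n ℕ.≤ m → m ℕ.< suc a ℕ.* suc n → m / suc n ≡ a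
    m/n≡a {m} {n} {a} lo hi with ℕ.m≤n⇒∃[o]m+o≡n lo
    ... | r , refl = [m*n+o]/n≡m a (suc n) r
                       (ℕ.+-cancelˡ-< (a ℕ.* suc n) r (suc n) (subst (a ℕ.* suc n ℕ.+ r ℕ.<_) (ℕ.+-comm (suc n) _) hi))

    floor-bounds : ∀ q a → ⟦ a /suc 0 ⟧ ℚᵘ.≤ toℚᵘ q → toℚᵘ q ℚᵘ.< ⟦ suc a /suc 0 ⟧ → floor q ≡ + a
    floor-bounds (mkℚ (+ m) n _) a (*≤* lo) (*<* hi) = trans (ℤ.*-identityˡ (+ (m / suc n))) (cong +_ (m/n≡a
      (ℤ.drop‿+≤+ (subst₂ ℤ._≤_ (sym (ℤ.pos-* a (suc n))) (ℤ.*-identityʳ (+ m)) lo))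
      (ℕ.≤-trans (ℕ.≤-reflexive (cong suc (sym (ℕ.*-identityʳ m))))
                 (ℤ.drop‿+<+ (subst₂ ℤ._<_ (sym (ℤ.pos-* m 1)) (sym (ℤ.pos-* (suc a) (suc n))) hi)))))
    floor-bounds (mkℚ -[1+ m ] n _) a (*≤* lo) _ with subst₂ ℤ._≤_ (sym (ℤ.pos-* a (suc n))) (ℤ.*-identityʳ -[1+ m ]) lo
    ... | ()

  ℕ→ℚ≡/suc : ∀ s d → ℕ→ℚ s ≡ (s ℕ.* suc d) /suc d
  ℕ→ℚ≡/suc s d = ≃⇒≡/suc (ℚᵘ.≃-trans (toℚᵘ-ℕ→ℚ s) (*≡* (trans (+u*+v s (suc d)) (sym (ℤ.*-identityʳ _)))))

  ℕ→ℚ*/suc : ∀ a u d → ℕ→ℚ a ℚ.* (u /suc d) ≡ (a ℕ.* u) /suc d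
  ℕ→ℚ*/suc a u d = ≃⇒≡/suc (ℚᵘ.≃-trans (ℚ.toℚᵘ-homo-* (ℕ→ℚ a) (u /suc d))
    (ℚᵘ.≃-trans (ℚᵘ.*-cong (toℚᵘ-ℕ→ℚ a) (toℚᵘ-/suc u d))
                (*≡* (cong₂ (λ x y → x ℤ.* + suc y) (+u*+v a u) (sym (ℕ.+-identityʳ d))))))

  /suc+ℕ→ℚ : ∀ j a d → j /suc d ℚ.+ ℕ→ℚ a ≡ (j ℕ.+ a ℕ.* suc d) /suc d
  /suc+ℕ→ℚ j a d = ≃⇒≡/suc (ℚᵘ.≃-trans (ℚ.toℚᵘ-homo-+ (j /suc d) (ℕ→ℚ a))
    (ℚᵘ.≃-trans (ℚᵘ.+-cong (toℚᵘ-/suc j d) (toℚᵘ-ℕ→ℚ a)) (*≡* (begin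
      (+ j ℤ.* + 1 ℤ.+ + a ℤ.* + suc d) ℤ.* + suc d
        ≡⟨ cong₂ (λ x y → (x ℤ.+ y) ℤ.* + suc d) (ℤ.*-identityʳ (+ j)) (+u*+v a (suc d)) ⟩
      + (j ℕ.+ a ℕ.* suc d) ℤ.* + suc d
        ≡⟨ cong (λ z → + (j ℕ.+ a ℕ.* suc d) ℤ.* + suc z) (sym (ℕ.*-identityʳ d)) ⟩
      + (j ℕ.+ a ℕ.* suc d) ℤ.* + suc (d ℕ.* 1) ∎))))
    where open ≡-Reasoning

  /suc+/suc : ∀ j y d → j /suc d ℚ.+ y /suc d ≡ (j ℕ.+ y) /suc d
  /suc+/suc j y d = ≃⇒≡/suc (ℚᵘ.≃-trans (ℚ.toℚᵘ-homo-+ (j /suc d) (y /suc d))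
    (ℚᵘ.≃-trans (ℚᵘ.+-cong (toℚᵘ-/suc j d) (toℚᵘ-/suc y d)) (*≡* (begin
      (+ j ℤ.* + suc d ℤ.+ + y ℤ.* + suc d) ℤ.* + suc d
        ≡⟨ cong₂ (λ x y → (x ℤ.+ y) ℤ.* + suc d) (+u*+v j (suc d)) (+u*+v y (suc d)) ⟩
      (+ (j ℕ.* suc d) ℤ.+ + (y ℕ.* suc d)) ℤ.* + suc d
        ≡⟨ cong (ℤ._* + suc d) (sym (ℤ.pos-+ (j ℕ.* suc d) (y ℕ.* suc d))) ⟩
      + (j ℕ.* suc d ℕ.+ y ℕ.* suc d) ℤ.* + suc d       ≡⟨ +u*+v (j ℕ.* suc d ℕ.+ y ℕ.* suc d) (suc d) ⟩
      + ((j ℕ.* suc d ℕ.+ y ℕ.* suc d) ℕ.* suc d)       ≡⟨ cong +_ (regroup j y (suc d)) ⟩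
      + ((j ℕ.+ y) ℕ.* (suc d ℕ.* suc d))               ≡⟨ sym (+u*+v (j ℕ.+ y) _) ⟩
      + (j ℕ.+ y) ℤ.* + (suc d ℕ.* suc d)               ∎))))
    where
    open ≡-Reasoning
    regroup : ∀ j y s → (j ℕ.* s ℕ.+ y ℕ.* s) ℕ.* s ≡ (j ℕ.+ y) ℕ.* (s ℕ.* s)
    regroup = solve-∀

  /suc-≤ : ∀ {u d v e} → u ℕ.* suc e ℕ.≤ v ℕ.* suc d → u /suc d ℚ.≤ v /suc e
  /suc-≤ {u} {d} {v} {e} le =
    ℚ.toℚᵘ-cancel-≤ (ℚᵘ.≤-respʳ-≃ (ℚᵘ.≃-sym (toℚᵘ-/suc v e))
                                   (ℚᵘ.≤-respˡ-≃ (ℚᵘ.≃-sym (toℚᵘ-/suc u d)) (⟦⟧-≤ le)))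

  /suc-< : ∀ {u d v e} → u ℕ.* suc e ℕ.< v ℕ.* suc d → u /suc d ℚ.< v /suc e
  /suc-< {u} {d} {v} {e} lt =
    ℚ.toℚᵘ-cancel-< (ℚᵘ.<-respʳ-≃ (ℚᵘ.≃-sym (toℚᵘ-/suc v e))
                                   (ℚᵘ.<-respˡ-≃ (ℚᵘ.≃-sym (toℚᵘ-/suc u d)) (⟦⟧-< lt)))

  0≤/suc : ∀ u d → ℚ.0ℚ ℚ.≤ u /suc d
  0≤/suc u d = subst (ℚ._≤ u /suc d) (ℚ.toℚᵘ-injective (toℚᵘ-/suc 0 0)) (/suc-≤ {0} {0} {u} {d} z≤n)

  /suc≤1 : ∀ {u d} → u ℕ.≤ suc d → u /suc d ℚ.≤ ℚ.1ℚ
  /suc≤1 {u} {d} u≤ = subst (u /suc d ℚ.≤_) (ℚ.toℚᵘ-injective (toℚᵘ-/suc 1 0))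
    (/suc-≤ {u} {d} {1} {0} (subst₂ ℕ._≤_ (sym (ℕ.*-identityʳ u)) (sym (ℕ.*-identityˡ (suc d))) u≤))

  floor-/suc : ∀ {a m d} → a ℕ.* suc d ℕ.≤ m → m ℕ.< suc a ℕ.* suc d → floor (m /suc d) ≡ + a
  floor-/suc {a} {m} {d} lo hi = floor-bounds (m /suc d) a
    (ℚᵘ.≤-respʳ-≃ (ℚᵘ.≃-sym (toℚᵘ-/suc m d)) (⟦⟧-≤ (subst (a ℕ.* suc d ℕ.≤_) (sym (ℕ.*-identityʳ m)) lo)))
    (ℚᵘ.<-respˡ-≃ (ℚᵘ.≃-sym (toℚᵘ-/suc m d)) (⟦⟧-< (subst (ℕ._< suc a ℕ.* suc d) (sym (ℕ.*-identityʳ m)) hi)))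

  x≡z+y⇒x-y≡z : ∀ {x y z} → x ≡ z ℚ.+ y → x ℚ.- y ≡ z
  x≡z+y⇒x-y≡z {x} {y} {z} eq = begin
    x ℚ.- y             ≡⟨ cong (ℚ._- y) eq ⟩
    (z ℚ.+ y) ℚ.- y     ≡⟨ ℚ.+-assoc z y (ℚ.- y) ⟩
    z ℚ.+ (y ℚ.- y)     ≡⟨ cong (z ℚ.+_) (ℚ.+-inverseʳ y) ⟩
    z ℚ.+ ℚ.0ℚ          ≡⟨ ℚ.+-identityʳ z ⟩
    z                   ∎
    where open ≡-Reasoning

module TentMap (p : ℕ) where
  open import Data.Nat using (_≡ᵇ_; _<ᵇ_; _∸_)
  open import Data.Nat.DivMod using (_%_)
  import Data.Integer as ℤ
  open import Data.Rational using (floor)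
  open import Data.Bool using (true; false; not)
  open import Data.Sum using (_⊎_; inj₁; inj₂)
  open import Relation.Binary.PropositionalEquality
  open Positional using (isOdd; isOdd-suc)
  open Fractions

  branch : ℚ → ℕ → ℚ
  branch x k = if k % 2 ≡ᵇ 0 then ℕ→ℚ p ℚ.* x ℚ.- ℕ→ℚ k else ℕ→ℚ (suc k) ℚ.- ℕ→ℚ p ℚ.* x

  clamp : ℕ → ℕ
  clamp k = if k <ᵇ p then k else p ∸ 1

  block : ℚ → ℕ
  block x = clamp ℤ.∣ floor (ℕ→ℚ p ℚ.* x) ∣

  g-at-block : ∀ {x k} → block x ≡ k → g p x ≡ branch x k
  g-at-block {x} = cong (branch x)

  branch-even : ∀ {k u d j} → isOdd k ≡ false → p ℕ.* u ≡ j ℕ.+ k ℕ.* suc d → branch (u /suc d) k ≡ j /suc d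
  branch-even {k} {u} {d} {j} even eq with k % 2 ≡ᵇ 0
  ... | true = x≡z+y⇒x-y≡z (begin
    ℕ→ℚ p ℚ.* (u /suc d)       ≡⟨ ℕ→ℚ*/suc p u d ⟩
    (p ℕ.* u) /suc d           ≡⟨ cong (_/suc d) eq ⟩
    (j ℕ.+ k ℕ.* suc d) /suc d ≡⟨ /suc+ℕ→ℚ j k d ⟨
    j /suc d ℚ.+ ℕ→ℚ k         ∎)
    where open ≡-Reasoning

  branch-odd : ∀ {k u d j} → isOdd k ≡ true → suc k ℕ.* suc d ≡ j ℕ.+ p ℕ.* u → branch (u /suc d) k ≡ j /suc d
  branch-odd {k} {u} {d} {j} odd eq with k % 2 ≡ᵇ 0
  ... | false = x≡z+y⇒x-y≡z (begin
    ℕ→ℚ (suc k)                       ≡⟨ ℕ→ℚ≡/suc (suc k) d ⟩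
    (suc k ℕ.* suc d) /suc d          ≡⟨ cong (_/suc d) eq ⟩
    (j ℕ.+ p ℕ.* u) /suc d            ≡⟨ /suc+/suc j (p ℕ.* u) d ⟨
    j /suc d ℚ.+ (p ℕ.* u) /suc d     ≡⟨ cong (j /suc d ℚ.+_) (ℕ→ℚ*/suc p u d) ⟨
    j /suc d ℚ.+ ℕ→ℚ p ℚ.* (u /suc d) ∎)
    where open ≡-Reasoning

  floor-p* : ∀ {a u d} → a ℕ.* suc d ℕ.≤ p ℕ.* u → p ℕ.* u ℕ.< suc a ℕ.* suc d →
             ℤ.∣ floor (ℕ→ℚ p ℚ.* (u /suc d)) ∣ ≡ a
  floor-p* {a} {u} {d} lo hi = trans (cong (λ q → ℤ.∣ floor q ∣) (ℕ→ℚ*/suc p u d)) (cong ℤ.∣_∣ (floor-/suc lo hi))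

  private
    clamp-< : ∀ {a} → a ℕ.< p → clamp a ≡ a
    clamp-< {a} a<p with a <ᵇ p | ℕ.<⇒<ᵇ a<p
    ... | true | _ = refl

    clamp-last : ∀ {a} → suc a ≡ p → clamp (suc a) ≡ a
    clamp-last {a} refl = cong (λ b → if b then suc a else a) (n<ᵇn a)
      where
      n<ᵇn : ∀ n → (n <ᵇ n) ≡ false
      n<ᵇn zero    = refl
      n<ᵇn (suc n) = n<ᵇn n

  block-inner : ∀ {a u d} → a ℕ.< p → a ℕ.* suc d ℕ.≤ p ℕ.* u → p ℕ.* u ℕ.< suc a ℕ.* suc d →
                block (u /suc d) ≡ a
  block-inner a<p lo hi = trans (cong clamp (floor-p* lo hi)) (clamp-< a<p)

  block-last : ∀ {a u d} → suc a ≡ p → p ℕ.* u ≡ suc a ℕ.* suc d → block (u /suc d) ≡ a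
  block-last {a} {u} {d} 1+a≡p eq = trans (cong clamp (floor-p* {suc a} {u} {d} (ℕ.≤-reflexive (sym eq)) hi)) (clamp-last 1+a≡p)
    where
    hi : p ℕ.* u ℕ.< suc (suc a) ℕ.* suc d
    hi = subst (ℕ._< suc (suc a) ℕ.* suc d) (sym eq) (ℕ.m<n+m (suc a ℕ.* suc d) (s≤s z≤n))

  private
    g-even-last : ∀ {a u d} → isOdd a ≡ false → p ℕ.* u ≡ suc a ℕ.* suc d → suc a ℕ.< p ⊎ suc a ≡ p →
                  g p (u /suc d) ≡ suc d /suc d
    g-even-last {a} {u} {d} even eq (inj₁ 1+a<p) =
      trans (g-at-block (block-inner 1+a<p (ℕ.≤-reflexive (sym eq)) hi))
            (branch-odd {suc a} (trans (isOdd-suc a) (cong not even)) (cong (suc d ℕ.+_) (sym eq)))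
      where
      hi : p ℕ.* u ℕ.< suc (suc a) ℕ.* suc d
      hi = subst (ℕ._< suc (suc a) ℕ.* suc d) (sym eq) (ℕ.m<n+m (suc a ℕ.* suc d) (s≤s z≤n))
    g-even-last {a} even eq (inj₂ 1+a≡p) = trans (g-at-block (block-last 1+a≡p eq)) (branch-even {a} even eq)

    g-odd-first : ∀ {a u d} → isOdd a ≡ true → suc a ℕ.* suc d ≡ p ℕ.* u → suc a ℕ.< p ⊎ suc a ≡ p →
                  g p (u /suc d) ≡ 0 /suc d
    g-odd-first {a} {u} {d} odd eq (inj₁ 1+a<p) =
      trans (g-at-block (block-inner 1+a<p (ℕ.≤-reflexive eq) hi))
            (branch-even {suc a} (trans (isOdd-suc a) (cong not odd)) (sym eq))
      where
      hi : p ℕ.* u ℕ.< suc (suc a) ℕ.* suc d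
      hi = subst (ℕ._< suc (suc a) ℕ.* suc d) eq (ℕ.m<n+m (suc a ℕ.* suc d) (s≤s z≤n))
    g-odd-first {a} odd eq (inj₂ 1+a≡p) = trans (g-at-block (block-last 1+a≡p (sym eq))) (branch-odd {a} odd eq)

    g-even-block′ : ∀ {a u d j} → a ℕ.< p → isOdd a ≡ false → p ℕ.* u ≡ j ℕ.+ a ℕ.* suc d →
                    j ℕ.< suc d ⊎ j ≡ suc d → g p (u /suc d) ≡ j /suc d
    g-even-block′ {a} {u} {d} {j} a<p even eq (inj₁ j<) = trans (g-at-block (block-inner a<p lo hi)) (branch-even {a} even eq)
      where
      lo : a ℕ.* suc d ℕ.≤ p ℕ.* u
      lo = subst (a ℕ.* suc d ℕ.≤_) (sym eq) (ℕ.m≤n+m _ j)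
      hi : p ℕ.* u ℕ.< suc a ℕ.* suc d
      hi = subst (ℕ._< suc a ℕ.* suc d) (sym eq) (ℕ.+-monoˡ-< (a ℕ.* suc d) j<)
    g-even-block′ a<p even eq (inj₂ refl) = g-even-last even eq (ℕ.m≤n⇒m<n∨m≡n a<p)

  g-even-block : ∀ {a u d j} → a ℕ.< p → isOdd a ≡ false → p ℕ.* u ≡ j ℕ.+ a ℕ.* suc d → j ℕ.≤ suc d →
                 g p (u /suc d) ≡ j /suc d
  g-even-block a<p even eq j≤ = g-even-block′ a<p even eq (ℕ.m≤n⇒m<n∨m≡n j≤)

  g-odd-block : ∀ {a u d j} → a ℕ.< p → isOdd a ≡ true → suc a ℕ.* suc d ≡ j ℕ.+ p ℕ.* u → j ℕ.≤ suc d →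
                g p (u /suc d) ≡ j /suc d
  g-odd-block {a} {u} {d} {suc j} a<p odd eq j≤ = trans (g-at-block (block-inner a<p lo hi)) (branch-odd {a} odd eq)
    where
    lo : a ℕ.* suc d ℕ.≤ p ℕ.* u
    lo = ℕ.+-cancelˡ-≤ (suc d) _ _ (subst (ℕ._≤ suc d ℕ.+ p ℕ.* u) (sym eq) (ℕ.+-monoˡ-≤ (p ℕ.* u) j≤))
    hi : p ℕ.* u ℕ.< suc a ℕ.* suc d
    hi = subst (p ℕ.* u ℕ.<_) (sym eq) (ℕ.m<n+m (p ℕ.* u) (s≤s z≤n))
  g-odd-block {j = zero} a<p odd eq j≤ = g-odd-first odd eq (ℕ.m≤n⇒m<n∨m≡n a<p)

module FixedPoints (p₀ : ℕ) where
  open import Data.Nat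
  open import Data.Nat.Properties
  open import Data.Nat.Tactic.RingSolver using (solve-∀)
  open import Data.Bool using (Bool; true; false; _xor_)
  open import Relation.Binary.PropositionalEquality
  open Positional
  open Fractions
  open Expansion p₀
  open TentMap p

  -- Numerators of g at k/(N-1) and (k+1)/(N+1), for k = a * m + r and N = n * m.
  numerator-even-low : ∀ {n m a r D} → n * m ≡ suc (suc D) → n * (a * m + r) ≡ (n * r + a) + a * suc D
  numerator-even-low {n} {m} {a} {r} {D} N≡ = begin
    n * (a * m + r)             ≡⟨ expand n a m r ⟩
    n * r + a * (n * m)         ≡⟨ cong (λ z → n * r + a * z) N≡ ⟩
    n * r + a * suc (suc D)     ≡⟨ collect (n * r) a D ⟩
    (n * r + a) + a * suc D     ∎
    where
    open ≡-Reasoning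
    expand : ∀ n a m r → n * (a * m + r) ≡ n * r + a * (n * m)
    expand = solve-∀
    collect : ∀ x a D → x + a * suc (suc D) ≡ (x + a) + a * suc D
    collect = solve-∀

  numerator-odd-low : ∀ {n m a r D} → a < n → r < m → n * m ≡ suc (suc D) →
                      suc a * suc D ≡ (n * (m ∸ r ∸ 1) + (n ∸ a ∸ 1)) + n * (a * m + r)
  numerator-odd-low {a = a} {r} {D} a<n r<m N≡ with m≤n⇒∃[o]m+o≡n r<m | m≤n⇒∃[o]m+o≡n a<n
  ... | e , refl | f , refl = begin
    suc a * suc D
      ≡⟨ +-cancelʳ-≡ (suc a) _ _ (trans (lhs a D) (trans (cong (suc a *_) (sym N≡)) (sym (rhs a f r e)))) ⟩
    (suc a + f) * e + f + (suc a + f) * (a * (suc r + e) + r)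
      ≡⟨ cong₂ (λ x y → (suc a + f) * x + y + (suc a + f) * (a * (suc r + e) + r))
               (m≡n+1+o⇒m∸n∸1≡o e (sym (+-suc r e))) (m≡n+1+o⇒m∸n∸1≡o f (sym (+-suc a f))) ⟨
    (suc a + f) * (suc r + e ∸ r ∸ 1) + (suc a + f ∸ a ∸ 1) + (suc a + f) * (a * (suc r + e) + r) ∎
    where
    open ≡-Reasoning
    lhs : ∀ a D → suc a * suc D + suc a ≡ suc a * suc (suc D)
    lhs = solve-∀
    rhs : ∀ a f r e → (suc a + f) * e + f + (suc a + f) * (a * (suc r + e) + r) + suc a ≡ suc a * ((suc a + f) * (suc r + e))
    rhs = solve-∀

  numerator-even-high : ∀ {n m a r} → a < n → n * suc (a * m + r) ≡ suc (n * r + (n ∸ a ∸ 1)) + a * suc (n * m)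
  numerator-even-high {m = m} {a} {r} a<n with m≤n⇒∃[o]m+o≡n a<n
  ... | f , refl = trans (expand a f m r) (cong (λ z → suc ((suc a + f) * r + z) + a * suc ((suc a + f) * m))
                                               (sym (m≡n+1+o⇒m∸n∸1≡o f (sym (+-suc a f)))))
    where
    expand : ∀ a f m r → (suc a + f) * suc (a * m + r) ≡ suc ((suc a + f) * r + f) + a * suc ((suc a + f) * m)
    expand = solve-∀

  numerator-odd-high : ∀ {n m a r} → r < m → suc a * suc (n * m) ≡ suc (n * (m ∸ r ∸ 1) + a) + n * suc (a * m + r)
  numerator-odd-high {n} {a = a} {r} r<m with m≤n⇒∃[o]m+o≡n r<m
  ... | e , refl = trans (expand n a r e) (cong (λ z → suc (n * z + a) + n * suc (a * (suc r + e) + r))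
                                               (sym (m≡n+1+o⇒m∸n∸1≡o e (sym (+-suc r e)))))
    where
    expand : ∀ n a r e → suc a * suc (n * (suc r + e)) ≡ suc (n * e + a) + n * suc (a * (suc r + e) + r)
    expand = solve-∀

  -- The candidates k/(N-1) and (k+1)/(N+1), N = p ^ suc t, for the k-th fixed point of g_p^(suc t).
  candidate : ℕ → Bool → ℕ → ℚ.ℚ
  candidate t false k = k /suc d t
  candidate t true  k = suc k /suc p ^ suc t

  fixedPoint : ℕ → ℕ → ℚ.ℚ
  fixedPoint t k = candidate t (digitParity (suc t) (Π (suc t) k)) k

  g-candidate : ∀ t o c {a r} → a < p → r < p ^ t → isOdd a ≡ c →
                g p (candidate t o (a * p ^ t + r)) ≡ candidate t o (p * reflectIf c (p ^ t) r + reflectIf (o xor c) p a)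
  g-candidate t false false {a} {r} a< r< odd =
    g-even-block a< odd (numerator-even-low {p} {p ^ t} {a} {r} (p^[1+t]≡2+d t)) (<N⇒≤1+d t (n*m+o<n*l r< a<))
  g-candidate t false true  {a} {r} a< r< odd =
    g-odd-block a< odd (numerator-odd-low {p} {p ^ t} {a} {r} a< r< (p^[1+t]≡2+d t))
                (<N⇒≤1+d t (n*m+o<n*l (reflectIf-< true r<) (reflectIf-< true a<)))
  g-candidate t true  false {a} {r} a< r< odd =
    g-even-block a< odd (numerator-even-high {p} {p ^ t} {a} {r} a<) (s≤s (<⇒≤ (n*m+o<n*l r< (reflectIf-< true a<))))
  g-candidate t true  true  {a} {r} a< r< odd =
    g-odd-block a< odd (numerator-odd-high {p} {p ^ t} {a} {r} r<) (s≤s (<⇒≤ (n*m+o<n*l (reflectIf-< true r<) a<)))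

  g-fixedPoint : ∀ t {k} → k < p ^ suc t → g p (fixedPoint t k) ≡ fixedPoint t (shift t k)
  g-fixedPoint t {k} k< = begin
    g p (candidate t o k)                                          ≡⟨ cong (λ z → g p (candidate t o z)) (digits t k) ⟩
    g p (candidate t o (lead t k * p ^ t + rest t k))              ≡⟨ g-candidate t o _ (lead-< t k<) (rest-< t k) refl ⟩
    candidate t o (p * low t k + reflectIf (o xor isOdd (lead t k)) p (lead t k))
                                                                   ≡⟨ cong (candidate t o) (shift-digits t k<) ⟨
    candidate t o (shift t k)                                      ≡⟨ cong (λ z → candidate t z (shift t k)) (digitParity-shift t k<) ⟨
    fixedPoint t (shift t k)                                       ∎
    where
    open ≡-Reasoning
    o = digitParity (suc t) (Π (suc t) k)

  iter-g-fixedPoint : ∀ t i {k} → k < p ^ suc t → iter i (g p) (fixedPoint t k) ≡ fixedPoint t (iter i (shift t) k)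
  iter-g-fixedPoint t zero    k< = refl
  iter-g-fixedPoint t (suc i) k< = trans (cong (g p) (iter-g-fixedPoint t i k<)) (g-fixedPoint t (iter-shift-< t i k<))

  fixedPoint-isFP : ∀ t {k} → k < p ^ suc t → IsFP p (suc t) (fixedPoint t k)
  fixedPoint-isFP t {k} k< = 0≤candidate o , candidate≤1 o
                           , trans (iter-g-fixedPoint t (suc t) k<) (cong (fixedPoint t) (shift-periodic t k<))
    where
    o = digitParity (suc t) (Π (suc t) k)
    0≤candidate : ∀ o → ℚ.0ℚ ℚ.≤ candidate t o k
    0≤candidate false = 0≤/suc k (d t)
    0≤candidate true  = 0≤/suc (suc k) (p ^ suc t)
    candidate≤1 : ∀ o → candidate t o k ℚ.≤ ℚ.1ℚ
    candidate≤1 false = /suc≤1 (<N⇒≤1+d t k<)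
    candidate≤1 true  = /suc≤1 (s≤s (<⇒≤ k<))

  -- (i+1)/N separates the candidates for i from those for every j > i.
  candidate-<-separator : ∀ t o {i} → suc i < p ^ suc t → candidate t o i ℚ.< suc i /suc suc (d t)
  candidate-<-separator t false {i} i< = /suc-< (begin-strict
    i * suc (suc (d t))        ≡⟨ *-suc i (suc (d t)) ⟩
    i + i * suc (d t)          <⟨ +-monoˡ-< (i * suc (d t)) (<N⇒≤1+d t i<) ⟩
    suc i * suc (d t)          ∎)
    where open ≤-Reasoning
  candidate-<-separator t true  {i} i< = /suc-< (*-monoʳ-< (suc i) (s≤s (≤-reflexive (sym (p^[1+t]≡2+d t)))))

  separator-≤-candidate : ∀ t o {i j} → i < j → j < p ^ suc t → suc i /suc suc (d t) ℚ.≤ candidate t o j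
  separator-≤-candidate t false i<j j< = /suc-≤ (*-mono-≤ i<j (n≤1+n (suc (d t))))
  separator-≤-candidate t true  {i} {j} i<j j< = /suc-≤ (begin
    suc i * suc (p ^ suc t)                ≡⟨ cong (λ z → suc i * suc z) (p^[1+t]≡2+d t) ⟩
    suc i * suc (suc (suc (d t)))          ≤⟨ *-monoˡ-≤ (suc (suc (suc (d t)))) i<j ⟩
    j * suc (suc (suc (d t)))              ≡⟨ *-suc j (suc (suc (d t))) ⟩
    j + j * suc (suc (d t))                ≤⟨ +-monoˡ-≤ (j * suc (suc (d t))) (<⇒≤ (subst (j <_) (p^[1+t]≡2+d t) j<)) ⟩
    suc j * suc (suc (d t))                ∎)
    where open ≤-Reasoning

  fixedPoint-< : ∀ t {i j} → i < j → j < p ^ suc t → fixedPoint t i ℚ.< fixedPoint t j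
  fixedPoint-< t {i} {j} i<j j< = ℚ.<-≤-trans (candidate-<-separator t (digitParity (suc t) (Π (suc t) i)) (≤-<-trans i<j j<))
                                             (separator-≤-candidate t (digitParity (suc t) (Π (suc t) j)) i<j j<)

module Enumeration where
  open import Relation.Binary.PropositionalEquality

  module _ {n : ℕ} (f : Fin n → Fin n) (f-< : ∀ i j → i Fin.< j → f i Fin.< f j) where

    private
      f-≥ : ∀ k (k<n : k ℕ.< n) → k ℕ.≤ toℕ (f (fromℕ< k<n))
      f-≥ zero    k<n = z≤n
      f-≥ (suc k) k<n = ℕ.≤-<-trans (f-≥ k k′<n) (f-< _ _ step)
        where
        k′<n : k ℕ.< n
        k′<n = ℕ.<-trans (ℕ.n<1+n k) k<n
        step : fromℕ< k′<n Fin.< fromℕ< k<n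
        step = subst₂ ℕ._<_ (sym (Fin.toℕ-fromℕ< k′<n)) (sym (Fin.toℕ-fromℕ< k<n)) (ℕ.n<1+n k)

      f-≤ : ∀ g k (k<n : k ℕ.< n) → suc k ℕ.+ g ≡ n → toℕ (f (fromℕ< k<n)) ℕ.≤ k
      f-≤ zero    k k<n refl =
        s≤s⁻¹ (subst (toℕ (f (fromℕ< k<n)) ℕ.<_) (ℕ.+-identityʳ (suc k)) (Fin.toℕ<n (f (fromℕ< k<n))))
      f-≤ (suc g) k k<n eq = s≤s⁻¹ (ℕ.<-≤-trans (f-< _ _ step) (f-≤ g (suc k) k′<n (trans (sym (ℕ.+-suc (suc k) g)) eq)))
        where
        k′<n : suc k ℕ.< n
        k′<n = subst (suc k ℕ.<_) eq (ℕ.m<m+n (suc k) ℕ.0<1+n)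
        step : fromℕ< k<n Fin.< fromℕ< k′<n
        step = subst₂ ℕ._<_ (sym (Fin.toℕ-fromℕ< k<n)) (sym (Fin.toℕ-fromℕ< k′<n)) (ℕ.n<1+n k)

    strictlyIncreasing⇒≡id : ∀ i → f i ≡ i
    strictlyIncreasing⇒≡id i with ℕ.m≤n⇒∃[o]m+o≡n (Fin.toℕ<n i)
    ... | g , eq = Fin.toℕ-injective (ℕ.≤-antisym
      (subst (λ j → toℕ (f j) ℕ.≤ toℕ i) (Fin.fromℕ<-toℕ i (Fin.toℕ<n i)) (f-≤ g (toℕ i) (Fin.toℕ<n i) eq))
      (subst (λ j → toℕ i ℕ.≤ toℕ (f j)) (Fin.fromℕ<-toℕ i (Fin.toℕ<n i)) (f-≥ (toℕ i) (Fin.toℕ<n i))))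

  enumeration-unique : ∀ {a ℓ} {A : Set a} {_<_ : Rel A ℓ} → IsStrictPartialOrder _≡_ _<_ →
                       ∀ {n} (x y : Fin n → A) → (∀ i j → i Fin.< j → x i < x j) → (∀ i j → i Fin.< j → y i < y j) →
                       (∀ k → ∃ λ j → x j ≡ y k) → ∀ k → x k ≡ y k
  enumeration-unique {_<_ = _<_} spo x y x-< y-< x-onto k =
    trans (cong x (sym (strictlyIncreasing⇒≡id τ τ-< k))) (proj₂ (x-onto k))
    where
    open IsStrictPartialOrder spo using (irrefl; asym)
    τ = λ k → proj₁ (x-onto k)
    τ-< : ∀ i j → i Fin.< j → τ i Fin.< τ j
    τ-< i j i<j with Fin.<-cmp (τ i) (τ j)
    ... | tri< τi<τj _ _ = τi<τj
    ... | tri≈ _ τi≡τj _ =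
      ⊥-elim (irrefl (trans (sym (proj₂ (x-onto i))) (trans (cong x τi≡τj) (proj₂ (x-onto j)))) (y-< i j i<j))
    ... | tri> _ _ τj<τi = ⊥-elim (asym (y-< i j i<j) (subst₂ _<_ (proj₂ (x-onto j)) (proj₂ (x-onto i)) (x-< _ _ τj<τi)))

module PrimitiveRoot {c ℓ : Level} (F : CommutativeRing c ℓ) (isField : IsField F) (D : ℕ) (card : HasCard F (suc (suc D)))
                     (α : CommutativeRing.Carrier F) (α-primitive : IsPrimitiveRoot F α) where
  open import Data.Nat.DivMod using (_%_; _/_; m≡m%n+[m/n]*n; m%n<n)
  open CommutativeRing F
  open import Algebra.Properties.Semiring.Exp semiring using (_^_; ^-congˡ; ^-homo-*; ^-assocʳ)
  open import Relation.Binary.Reasoning.Setoid setoid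

  private
    element : Fin (suc (suc D)) → Carrier
    element = proj₁ card

    element-injective : ∀ i j → element i ≈ element j → i ≡ j
    element-injective = proj₁ (proj₂ card)

    index : Carrier → Fin (suc (suc D))
    index y = proj₁ (proj₂ (proj₂ card) y)

    element-index : ∀ y → element (index y) ≈ y
    element-index y = proj₂ (proj₂ (proj₂ card) y)

    index-≈ : ∀ {x y} → index x ≡ index y → x ≈ y
    index-≈ {x} {y} eq = trans (sym (element-index x)) (trans (reflexive (≡.cong element eq)) (element-index y))

    log : ∀ y → ¬ (y ≈ 0#) → ℕ
    log y y≉0 = proj₁ (proj₂ α-primitive y y≉0)

    α^log : ∀ y y≉0 → α ^ log y y≉0 ≈ y
    α^log y y≉0 = proj₂ (proj₂ α-primitive y y≉0)

  ≈-dec : ∀ x y → Dec (x ≈ y)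
  ≈-dec x y with index x Fin.≟ index y
  ... | yes eq  = yes (index-≈ eq)
  ... | no  neq = no λ x≈y → neq (element-injective _ _ (trans (element-index x) (trans x≈y (sym (element-index y)))))

  *-cancelˡ : ∀ {x y z} → ¬ (x ≈ 0#) → x * y ≈ x * z → y ≈ z
  *-cancelˡ {x} {y} {z} x≉0 xy≈xz with proj₂ isField x x≉0
  ... | x⁻¹ , xx⁻¹≈1 = begin
    y              ≈⟨ *-identityˡ y ⟨
    1# * y         ≈⟨ *-congʳ (trans (sym xx⁻¹≈1) (*-comm x x⁻¹)) ⟩
    x⁻¹ * x * y    ≈⟨ *-assoc x⁻¹ x y ⟩
    x⁻¹ * (x * y)  ≈⟨ *-congˡ xy≈xz ⟩
    x⁻¹ * (x * z)  ≈⟨ *-assoc x⁻¹ x z ⟨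
    x⁻¹ * x * z    ≈⟨ *-congʳ (trans (*-comm x⁻¹ x) xx⁻¹≈1) ⟩
    1# * z         ≈⟨ *-identityˡ z ⟩
    z              ∎

  1^n≈1 : ∀ n → 1# ^ n ≈ 1#
  1^n≈1 zero    = refl
  1^n≈1 (suc n) = trans (*-identityˡ _) (1^n≈1 n)

  ^-periodic : ∀ {x} s → x ^ s ≈ 1# → ∀ m k → x ^ (m ℕ.+ k ℕ.* s) ≈ x ^ m
  ^-periodic {x} s x^s≈1 m k = begin
    x ^ (m ℕ.+ k ℕ.* s)       ≈⟨ ^-homo-* x m (k ℕ.* s) ⟩
    x ^ m * x ^ (k ℕ.* s)     ≡⟨ ≡.cong (λ e → x ^ m * x ^ e) (ℕ.*-comm k s) ⟩
    x ^ m * x ^ (s ℕ.* k)     ≈⟨ *-congˡ (sym (^-assocʳ x s k)) ⟩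
    x ^ m * (x ^ s) ^ k       ≈⟨ *-congˡ (trans (^-congˡ k x^s≈1) (1^n≈1 k)) ⟩
    x ^ m * 1#                ≈⟨ *-identityʳ _ ⟩
    x ^ m                     ∎

  ^-% : ∀ {x} s → x ^ suc s ≈ 1# → ∀ k → x ^ k ≈ x ^ (k % suc s)
  ^-% {x} s x^s≈1 k = trans (reflexive (≡.cong (x ^_) (m≡m%n+[m/n]*n k (suc s)))) (^-periodic (suc s) x^s≈1 (k % suc s) (k / suc s))

  α^≉0 : ∀ k → ¬ (α ^ k ≈ 0#)
  α^≉0 zero    = proj₁ isField
  α^≉0 (suc k) α^[1+k]≈0 = α^≉0 k (*-cancelˡ (proj₁ α-primitive) (trans α^[1+k]≈0 (sym (zeroʳ α))))

  α^-cancel : ∀ i e → α ^ i ≈ α ^ (i ℕ.+ e) → α ^ e ≈ 1#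
  α^-cancel i e eq = *-cancelˡ (α^≉0 i) (begin
    α ^ i * α ^ e   ≈⟨ ^-homo-* α i e ⟨
    α ^ (i ℕ.+ e)   ≈⟨ eq ⟨
    α ^ i           ≈⟨ *-identityʳ _ ⟨
    α ^ i * 1#      ∎)

  -- If α ^ (1 + e) = 1 then y ↦ 1 + log y mod (1 + e) (and 0 ↦ 0) embeds the field into Fin (2 + e).
  order-≥ : ∀ e → α ^ suc e ≈ 1# → D ℕ.≤ e
  order-≥ e α^[1+e]≈1 = s≤s⁻¹ (s≤s⁻¹ (Fin.injective⇒≤ {f = encode ∘ element}
                                         (λ eq → element-injective _ _ (encode-injective eq))))
    where
    encode : Carrier → Fin (suc (suc e))
    encode y with ≈-dec y 0#
    ... | yes _   = Fin.zero
    ... | no y≉0 = Fin.suc (fromℕ< (m%n<n (log y y≉0) (suc e)))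

    decode : Fin (suc (suc e)) → Carrier
    decode Fin.zero    = 0#
    decode (Fin.suc i) = α ^ toℕ i

    decode-encode : ∀ y → decode (encode y) ≈ y
    decode-encode y with ≈-dec y 0#
    ... | yes y≈0 = sym y≈0
    ... | no y≉0 = begin
      α ^ toℕ (fromℕ< (m%n<n (log y y≉0) (suc e))) ≡⟨ ≡.cong (α ^_) (Fin.toℕ-fromℕ< (m%n<n (log y y≉0) (suc e))) ⟩
      α ^ (log y y≉0 % suc e)                       ≈⟨ ^-% e α^[1+e]≈1 (log y y≉0) ⟨
      α ^ log y y≉0                                 ≈⟨ α^log y y≉0 ⟩
      y                                             ∎

    encode-injective : ∀ {y z} → encode y ≡ encode z → y ≈ z
    encode-injective {y} {z} eq = trans (sym (decode-encode y)) (trans (reflexive (≡.cong decode eq)) (decode-encode z))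

  private
    value : Fin (suc (suc (suc D))) → Carrier
    value Fin.zero    = 0#
    value (Fin.suc i) = α ^ toℕ i

  -- Pigeonhole on the 3 + D values 0, α ^ 0, …, α ^ (1 + D) in a field with 2 + D elements.
  α-has-small-order : ∃ λ e → (e ℕ.≤ D) × (α ^ suc e ≈ 1#)
  α-has-small-order with Fin.pigeonhole (ℕ.n<1+n (suc (suc D))) (index ∘ value)
  ... | Fin.zero  , Fin.zero  , () , _
  ... | Fin.suc i , Fin.zero  , () , _
  ... | Fin.zero  , Fin.suc j , _  , eq = ⊥-elim (α^≉0 (toℕ j) (sym (index-≈ eq)))
  ... | Fin.suc i , Fin.suc j , i<j , eq with ℕ.m≤n⇒∃[o]m+o≡n (s≤s⁻¹ i<j)
  ...   | e , i+1+e≡j = e , e≤D , α^-cancel (toℕ i) (suc e) (trans (index-≈ eq) (reflexive (≡.cong (α ^_) j≡i+[1+e])))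
    where
    j≡i+[1+e] : toℕ j ≡ toℕ i ℕ.+ suc e
    j≡i+[1+e] = ≡.trans (≡.sym i+1+e≡j) (≡.sym (ℕ.+-suc (toℕ i) e))
    e≤D : e ℕ.≤ D
    e≤D = s≤s⁻¹ (ℕ.≤-trans (ℕ.≤-trans (s≤s (ℕ.m≤n+m e (toℕ i))) (ℕ.≤-reflexive i+1+e≡j))
                           (s≤s⁻¹ (Fin.toℕ<n j)))

  α^[1+D]≈1 : α ^ suc D ≈ 1#
  α^[1+D]≈1 with α-has-small-order
  ... | e , e≤D , α^[1+e]≈1 = ≡.subst (λ k → α ^ suc k ≈ 1#) (ℕ.≤-antisym e≤D (order-≥ e α^[1+e]≈1)) α^[1+e]≈1

  α^-distinct : ∀ {u w} → 0 ℕ.< u → u ℕ.< w → w ℕ.≤ suc D → ¬ (α ^ u ≈ α ^ w)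
  α^-distinct {u} {w} 0<u u<w w≤ eq with ℕ.m≤n⇒∃[o]m+o≡n u<w
  ... | e , 1+u+e≡w = ℕ.<⇒≱ e<D (order-≥ e (α^-cancel u (suc e) (trans eq (reflexive (≡.cong (α ^_) w≡u+[1+e])))))
    where
    w≡u+[1+e] : w ≡ u ℕ.+ suc e
    w≡u+[1+e] = ≡.trans (≡.sym 1+u+e≡w) (≡.sym (ℕ.+-suc u e))
    e<D : e ℕ.< D
    e<D = ℕ.≤-trans (ℕ.+-monoˡ-≤ e 0<u) (s≤s⁻¹ (ℕ.≤-trans (ℕ.≤-reflexive 1+u+e≡w) w≤))

  α^-injective : ∀ {u w} → 0 ℕ.< u → u ℕ.≤ suc D → 0 ℕ.< w → w ℕ.≤ suc D → α ^ u ≈ α ^ w → u ≡ w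
  α^-injective {u} {w} 0<u u≤ 0<w w≤ eq with ℕ.<-cmp u w
  ... | tri< u<w _ _ = ⊥-elim (α^-distinct 0<u u<w w≤ eq)
  ... | tri≈ _ u≡w _ = u≡w
  ... | tri> _ _ w<u = ⊥-elim (α^-distinct 0<w w<u u≤ (sym eq))

  private
    α^[log%]≈ : ∀ y y≉0 {s} → log y y≉0 % suc D ≡ s → α ^ s ≈ y
    α^[log%]≈ y y≉0 eq = trans (reflexive (≡.cong (α ^_) (≡.sym eq))) (trans (sym (^-% D α^[1+D]≈1 (log y y≉0))) (α^log y y≉0))

  α^-surjective : ∀ y → ¬ (y ≈ 0#) → ∃ λ s → (0 ℕ.< s) × (s ℕ.≤ suc D) × (α ^ s ≈ y)
  α^-surjective y y≉0 with log y y≉0 % suc D in eq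
  ... | zero  = suc D , z<s , ℕ.≤-refl , trans α^[1+D]≈1 (α^[log%]≈ y y≉0 eq)
  ... | suc s = suc s , z<s , ℕ.<⇒≤ (≡.subst (ℕ._< suc D) eq (m%n<n (log y y≉0) (suc D))) , α^[log%]≈ y y≉0 eq

module Correspondence (p₀ t : ℕ) {c ℓ : Level} (F : CommutativeRing c ℓ) (isField : IsField F)
                      (card : HasCard F (suc (suc p₀) ℕ.^ suc t))
                      (α : CommutativeRing.Carrier F) (α-primitive : IsPrimitiveRoot F α) where
  open Expansion p₀
  open CommutativeRing F
  open PrimitiveRoot F isField (d t) (≡.subst (HasCard F) (p^[1+t]≡2+d t) card) α α-primitive
  open import Algebra.Properties.Semiring.Exp semiring using (_^_; ^-assocʳ)
  open import Relation.Binary.Reasoning.Setoid setoid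

  N : ℕ
  N = p ℕ.^ suc t

  -- Defs.B F p (suc t) α k unfolds to b (toℕ k).
  b : ℕ → Carrier
  b m = if m ℕ.≡ᵇ 0 then 0# else α ^ Π (suc t) m

  b-pos : ∀ {m} → 0 ℕ.< m → b m ≡ α ^ Π (suc t) m
  b-pos {suc m} _ = ≡.refl

  pos⇒Π-pos : ∀ {m} → 0 ℕ.< m → m ℕ.< N → 0 ℕ.< Π (suc t) m
  pos⇒Π-pos {suc m} _ m< = ℕ.n≢0⇒n>0 λ Πm≡0 →
    ℕ.1+n≢0 (Π-injective (suc t) m< (ℕ.m^n>0 p (suc t)) (≡.trans Πm≡0 (≡.sym (Π-zero (suc t)))))

  Π-pos⇒pos : ∀ {m} → 0 ℕ.< Π (suc t) m → 0 ℕ.< m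
  Π-pos⇒pos {zero}  0<Π0 = ⊥-elim (ℕ.<-irrefl (≡.sym (Π-zero (suc t))) 0<Π0)
  Π-pos⇒pos {suc m} _    = z<s

  Π-≤ : ∀ {m} → m ℕ.< N → Π (suc t) m ℕ.≤ suc (d t)
  Π-≤ m< = <N⇒≤1+d t (Π-< (suc t) m<)

  b-injective : ∀ {i j} → i ℕ.< N → j ℕ.< N → b i ≈ b j → i ≡ j
  b-injective {zero}  {zero}  _  _  _  = ≡.refl
  b-injective {zero}  {suc j} _  _  eq = ⊥-elim (α^≉0 (Π (suc t) (suc j)) (sym eq))
  b-injective {suc i} {zero}  _  _  eq = ⊥-elim (α^≉0 (Π (suc t) (suc i)) eq)
  b-injective {suc i} {suc j} i< j< eq =
    Π-injective (suc t) i< j< (α^-injective (pos⇒Π-pos z<s i<) (Π-≤ i<) (pos⇒Π-pos z<s j<) (Π-≤ j<) eq)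

  b-surjective : ∀ y → ∃ λ m → m ℕ.< N × b m ≈ y
  b-surjective y with ≈-dec y 0#
  ... | yes y≈0 = 0 , ℕ.m^n>0 p (suc t) , sym y≈0
  ... | no  y≉0 with α^-surjective y y≉0
  ...   | s , 0<s , s≤ , α^s≈y = Π⁻¹ (suc t) s , Π⁻¹-< (suc t) s< , trans (reflexive bm≡α^s) α^s≈y
    where
    s< : s ℕ.< N
    s< = ≡.subst (s ℕ.<_) (≡.sym (p^[1+t]≡2+d t)) (s≤s s≤)
    ΠΠ⁻¹s≡s : Π (suc t) (Π⁻¹ (suc t) s) ≡ s
    ΠΠ⁻¹s≡s = Π-Π⁻¹ (suc t) s<
    bm≡α^s : b (Π⁻¹ (suc t) s) ≡ α ^ s
    bm≡α^s = ≡.trans (b-pos (Π-pos⇒pos (≡.subst (0 ℕ.<_) (≡.sym ΠΠ⁻¹s≡s) 0<s))) (≡.cong (α ^_) ΠΠ⁻¹s≡s)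

  b-frobenius : ∀ {m} → m ℕ.< N → b m ^ p ≈ b (shift t m)
  b-frobenius {zero}  _  = trans (zeroˡ _) (reflexive (≡.cong b (≡.sym (shift-zero t))))
  b-frobenius {suc m} m< = begin
    (α ^ X) ^ p                                 ≈⟨ ^-assocʳ α X p ⟩
    α ^ (X ℕ.* p)                               ≡⟨ ≡.cong (α ^_) (≡.trans (ℕ.*-comm X p) (p*m≡rotate t X)) ⟩
    α ^ (rotate t X ℕ.+ lead t X ℕ.* suc (d t)) ≈⟨ ^-periodic (suc (d t)) α^[1+D]≈1 (rotate t X) (lead t X) ⟩
    α ^ rotate t X                              ≡⟨ ≡.cong (α ^_) (Π-shift t m<) ⟨
    α ^ Π (suc t) (shift t (suc m))             ≡⟨ b-pos (Π-pos⇒pos 0<Πshift) ⟨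
    b (shift t (suc m))                         ∎
    where
    X = Π (suc t) (suc m)
    0<Πshift : 0 ℕ.< Π (suc t) (shift t (suc m))
    0<Πshift = ≡.subst (0 ℕ.<_) (≡.sym (Π-shift t m<)) (rotate-pos t (pos⇒Π-pos z<s m<))

  B-injective : ∀ i j → B F p (suc t) α i ≈ B F p (suc t) α j → i ≡ j
  B-injective i j eq = Fin.toℕ-injective (b-injective (Fin.toℕ<n i) (Fin.toℕ<n j) eq)

  B-surjective : ∀ y → ∃ λ k → B F p (suc t) α k ≈ y
  B-surjective y with b-surjective y
  ... | m , m< , bm≈y = fromℕ< m< , trans (reflexive (≡.cong b (Fin.toℕ-fromℕ< m<))) bm≈y

  next : Fin N → Fin N
  next k = fromℕ< (shift-< t (Fin.toℕ<n k))

  B-frobenius : ∀ k → pow F (B F p (suc t) α k) p ≈ B F p (suc t) α (next k)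
  B-frobenius k = trans (b-frobenius (Fin.toℕ<n k)) (reflexive (≡.cong b (≡.sym (Fin.toℕ-fromℕ< (shift-< t (Fin.toℕ<n k))))))

-- Opened only here, since above _^_ is the power in a ring.
open import Data.Nat using (_≤_; _^_)

theorem2 : {c ℓ : Level} (F : CommutativeRing c ℓ) (p n : ℕ) → Prime p → 1 ≤ n →
  IsField F → HasCard F (p ^ n) →
  (α : CommutativeRing.Carrier F) → IsPrimitiveRoot F α →
  (x : Fin (p ^ n) → ℚ) →
  (∀ i j → i Fin.< j → x i ℚ.< x j) →
  (∀ k → IsFP p n (x k)) →
  (∀ y → IsFP p n y → ∃ λ k → x k ≡ y) →
  ((∀ i j → CommutativeRing._≈_ F (B F p n α i) (B F p n α j) → i ≡ j)
   × (∀ y → ∃ λ k → CommutativeRing._≈_ F (B F p n α k) y))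
  × (∀ k → ∃ λ j → (g p (x k) ≡ x j)
       × CommutativeRing._≈_ F (pow F (B F p n α k) p) (B F p n α j))
theorem2 F zero          n       p-prime = λ _ → ⊥-elim (¬prime[0] p-prime)
theorem2 F (suc zero)    n       p-prime = λ _ → ⊥-elim (¬prime[1] p-prime)
theorem2 F (suc (suc p₀)) zero   _ ()
theorem2 F (suc (suc p₀)) (suc t) _ _ isField card α α-primitive x x-< _ x-onto =
  (B-injective , B-surjective) , λ k → next k , g-step k , B-frobenius k
  where
  open Expansion p₀ using (p; shift; shift-<)
  open FixedPoints p₀ using (fixedPoint; fixedPoint-<; fixedPoint-isFP; g-fixedPoint)
  open Enumeration using (enumeration-unique)
  open Correspondence p₀ t F isField card α α-primitive using (B-injective; B-surjective; next; B-frobenius)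

  -- The hypothesis that each x k is a fixed point is redundant: increasing values covering all of them are them.
  x≡fixedPoint : ∀ k → x k ≡ fixedPoint t (toℕ k)
  x≡fixedPoint = enumeration-unique ℚ.<-isStrictPartialOrder x (fixedPoint t ∘ toℕ) x-<
    (λ i j i<j → fixedPoint-< t i<j (Fin.toℕ<n j)) (λ k → x-onto _ (fixedPoint-isFP t (Fin.toℕ<n k)))

  g-step : ∀ k → g p (x k) ≡ x (next k)
  g-step k = begin
    g p (x k)                       ≡⟨ ≡.cong (g p) (x≡fixedPoint k) ⟩
    g p (fixedPoint t (toℕ k))      ≡⟨ g-fixedPoint t (Fin.toℕ<n k) ⟩
    fixedPoint t (shift t (toℕ k))  ≡⟨ ≡.cong (fixedPoint t) (Fin.toℕ-fromℕ< (shift-< t (Fin.toℕ<n k))) ⟨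
    fixedPoint t (toℕ (next k))     ≡⟨ x≡fixedPoint (next k) ⟨
    x (next k)                      ∎
    where open ≡.≡-Reasoning
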